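{- Let $D$ be a set of rules of the sequent calculus described in the context with $D\supseteq\{R_1,R_2,R_4,R_5,R_8\}$ or $D\supseteq\{R_1,R_2,R_4,R_5,R_9\}$. Let $\Phi\subseteq F^S$, $\varphi\in F^S$ and $x_m\in X$. If $\Phi\cup\{\exists x_m\varphi\}$ is $D$-consistent, then $\Phi\cup\{\varphi\frac{x_n}{x_m}\}$ is $D$-consistent for every $x_n\in X\setminus\mathrm{free}(\Phi\cup\{\exists x_m\varphi\})$.
   Context: Syntax. $S$ is an at most countable set of symbols with signed arity $\#\colon S\to\mathbb{Z}$ ($0$: constant; $n>0$: $n$-ary function symbol; $-n<0$: $n$-ary relation symbol). $X=\{x_1,x_2,\dots\}$ is a countably infinite set of variables; logical symbols $\downarrow$ (NOR), $\equiv$ (equality), $\exists$. Polish notation: terms are variables, constants, $f t_1\dots t_n$; atomic formulas $\equiv t_1t_2$ and $Rt_1\dots t_n$; formulas ($F^S$) are atomic formulas, $\downarrow\varphi\psi$, $\exists x\varphi$. $\neg\varphi$ abbreviates $\downarrow\varphi\varphi$. $\varphi\frac{t}{x}$ is substitution of $t$ for free occurrences of $x$; $\mathrm{free}(\Phi)$ is the set of variables free in formulas of $\Phi$. Sequent calculus. A sequent $\Gamma\ \varphi$: finite (possibly empty) $\Gamma\subseteq F^S$ and formula $\varphi$. Rules: $R_0$: $\Gamma\ \varphi$ (no premises) if $\varphi\in\Gamma$. $R_1$: from $\Gamma\ \varphi$ infer $\Gamma'\ \varphi$ for $\Gamma\subseteq\Gamma'$. $R_2$: $\emptyset\ \equiv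 tt$ (no premises). $R_3$: from $\Gamma\ \varphi\frac{t}{x}$ infer $\Gamma\cup\{\equiv tt'\}\ \varphi\frac{t'}{x}$. $R_4$: from $\Gamma\ \varphi\frac{t}{x}$ infer $\Gamma\ \exists x\varphi$. $R_5$: from $\Gamma\cup\{\varphi\frac{x'}{x}\}\ \psi$ infer $\Gamma\cup\{\exists x\varphi\}\ \psi$, if $x'\notin\mathrm{free}(\Gamma\cup\{\exists x\varphi,\psi\})$. $R_6$: from $\Gamma\ \neg\varphi_1$ and $\Gamma\ \neg\varphi_2$ infer $\Gamma\ \downarrow\varphi_1\varphi_2$. $R_7$: from $\Gamma\ \downarrow\varphi_1\varphi_2$ infer $\Gamma\ \downarrow\varphi_2\varphi_1$. $R_8$: from $\Gamma\cup\{\varphi\}\ \psi$ and $\Gamma\cup\{\varphi\}\ \neg\psi$ infer $\Gamma\ \neg\varphi$. $R_9$: from $\Gamma\cup\{\neg\varphi\}\ \psi$ and $\Gamma\cup\{\neg\varphi\}\ \neg\psi$ infer $\Gamma\ \varphi$. $\Phi\vdash_D\varphi$ iff $\Gamma\ \varphi$ is derivable with rules of $D$ for some finite $\Gamma\subseteq\Phi$. $\Phi$ is $D$-consistent iff no $\varphi$ has both $\Phi\vdash_D\varphi$ and $\Phi\vdash_D\neg\varphi$. -}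

module Defs where

open import Data.Nat using (ℕ; zero; suc; _≟_)
open import Data.Integer using (ℤ; +_; -[1+_])
open import Data.Bool using (Bool; true; false; if_then_else_; _∧_; not)
open import Data.List using (List; []; _∷_; _++_; length; concatMap; filter; map)
open import Data.List.Membership.Propositional using (_∈_; _∉_)
open import Data.List.Relation.Binary.Subset.Propositional using (_⊆_)
open import Data.Vec using (Vec; []; _∷_)
open import Data.Product using (_×_; _,_; Σ; proj₁; proj₂)
open import Data.Sum using (_⊎_)
open import Relation.Binary.PropositionalEquality using (_≡_)
open import Relation.Nullary using (¬_; does)

data Rule : Set where
  R0 R1 R2 R3 R4 R5 R6 R7 R8 R9 : Rule

elem : ℕ → List ℕ → Bool
elem x []       = false
elem x (y ∷ ys) = if does (x ≟ y) then true else elem x ys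

remove : ℕ → List ℕ → List ℕ
remove x []       = []
remove x (y ∷ ys) = if does (x ≟ y) then remove x ys else y ∷ remove x ys

filterB : {A : Set} → (A → Bool) → List A → List A
filterB p []       = []
filterB p (a ∷ as) = if p a then a ∷ filterB p as else filterB p as

firstNotIn : List ℕ → ℕ
firstNotIn L = go (length L) 0
  where
  go : ℕ → ℕ → ℕ
  go zero    k = k
  go (suc f) k = if elem k L then go f (suc k) else k

-- Syntax over a symbol set S with signed arity #.
-- Variable index n : ℕ stands for the variable x_(n+1).

module Syntax (Sym : Set) (ar : Sym → ℤ) where

  data Term : Set where
    var : ℕ → Term
    -- constants (# f = 0) and n-ary function symbols (# f = n > 0)
    app : (f : Sym) {n : ℕ} → ar f ≡ + n → Vec Term n → Term

  data Formula : Set where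
    eq  : Term → Term → Formula
    rel : (R : Sym) {n : ℕ} → ar R ≡ -[1+ n ] → Vec Term (suc n) → Formula
    nor : Formula → Formula → Formula
    ex  : ℕ → Formula → Formula

  neg : Formula → Formula
  neg φ = nor φ φ

  varsT  : Term → List ℕ
  varsTs : ∀ {n} → Vec Term n → List ℕ
  varsT (var x)       = x ∷ []
  varsT (app f _ ts)  = varsTs ts
  varsTs []       = []
  varsTs (t ∷ ts) = varsT t ++ varsTs ts

  free : Formula → List ℕ
  free (eq t u)      = varsT t ++ varsT u
  free (rel R _ ts)  = varsTs ts
  free (nor φ ψ)     = free φ ++ free ψ
  free (ex x φ)      = remove x (free φ)

  vars : Formula → List ℕ
  vars (eq t u)      = varsT t ++ varsT u
  vars (rel R _ ts)  = varsTs ts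
  vars (nor φ ψ)     = vars φ ++ vars ψ
  vars (ex x φ)      = x ∷ vars φ

  freeL : List Formula → List ℕ
  freeL = concatMap free

  -- Simultaneous substitution [t₁…t_r / x₁…x_r] as a list of pairs
  -- (Ebbinghaus–Flum–Thomas, Def. III.8.3; capture-avoiding).
  Sub : Set
  Sub = List (ℕ × Term)

  lookupV : Sub → ℕ → Term
  lookupV []             y = var y
  lookupV ((x , t) ∷ σ)  y = if does (y ≟ x) then t else lookupV σ y

  subT  : Sub → Term → Term
  subTs : ∀ {n} → Sub → Vec Term n → Vec Term n
  subT σ (var y)      = lookupV σ y
  subT σ (app f p ts) = app f p (subTs σ ts)
  subTs σ []       = []
  subTs σ (t ∷ ts) = subT σ t ∷ subTs σ ts

  sub : Sub → Formula → Formula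
  sub σ (eq t u)     = eq (subT σ t) (subT σ u)
  sub σ (rel R p ts) = rel R p (subTs σ ts)
  sub σ (nor φ ψ)    = nor (sub σ φ) (sub σ ψ)
  sub σ (ex x φ)     = ex u (sub (relv ++ (x , var u) ∷ []) φ)
    where
    relv : Sub
    relv = filterB (λ p → elem (proj₁ p) (free (ex x φ)) ∧ not (does (proj₁ p ≟ x))) σ
    relVars : List ℕ
    relVars = concatMap (λ p → varsT (proj₂ p)) relv
    u : ℕ
    u = if elem x relVars then firstNotIn (vars (ex x φ) ++ relVars) else x

  _[_/_] : Formula → Term → ℕ → Formula
  φ [ t / x ] = sub ((x , t) ∷ []) φ

  _≋_ : List Formula → List Formula → Set
  Γ ≋ Δ = (Γ ⊆ Δ) × (Δ ⊆ Γ)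

  -- Derivable sequents Γ φ using only rules from D.
  -- Γ is a finite set represented by a list; rules whose conclusion
  -- antecedent is a union are stated up to set equality ≋.
  data Der (D : Rule → Set) : List Formula → Formula → Set where
    r0 : ∀ {Γ φ} → D R0 → φ ∈ Γ → Der D Γ φ
    r1 : ∀ {Γ Γ' φ} → D R1 → Der D Γ φ → Γ ⊆ Γ' → Der D Γ' φ
    r2 : ∀ {t} → D R2 → Der D [] (eq t t)
    r3 : ∀ {Γ Γ' φ t t' x} → D R3 → Der D Γ (φ [ t / x ]) →
         Γ' ≋ (eq t t' ∷ Γ) → Der D Γ' (φ [ t' / x ])
    r4 : ∀ {Γ φ t x} → D R4 → Der D Γ (φ [ t / x ]) → Der D Γ (ex x φ)
    r5 : ∀ {Γ Γ' φ ψ x x'} → D R5 → Der D ((φ [ var x' / x ]) ∷ Γ) ψ →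
         x' ∉ freeL (ex x φ ∷ ψ ∷ Γ) →
         Γ' ≋ (ex x φ ∷ Γ) → Der D Γ' ψ
    r6 : ∀ {Γ φ₁ φ₂} → D R6 → Der D Γ (neg φ₁) → Der D Γ (neg φ₂) → Der D Γ (nor φ₁ φ₂)
    r7 : ∀ {Γ φ₁ φ₂} → D R7 → Der D Γ (nor φ₁ φ₂) → Der D Γ (nor φ₂ φ₁)
    r8 : ∀ {Γ φ ψ} → D R8 → Der D (φ ∷ Γ) ψ → Der D (φ ∷ Γ) (neg ψ) → Der D Γ (neg φ)
    r9 : ∀ {Γ φ ψ} → D R9 → Der D (neg φ ∷ Γ) ψ → Der D (neg φ ∷ Γ) (neg ψ) → Der D Γ φ

  _⊢[_]_ : (Formula → Set) → (Rule → Set) → Formula → Set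
  Φ ⊢[ D ] φ = Σ (List Formula) λ Γ → (∀ {ψ} → ψ ∈ Γ → Φ ψ) × Der D Γ φ

  Consistent : (Rule → Set) → (Formula → Set) → Set
  Consistent D Φ = ∀ φ → ¬ ((Φ ⊢[ D ] φ) × (Φ ⊢[ D ] neg φ))

  _∪｛_｝ : (Formula → Set) → Formula → (Formula → Set)
  (Φ ∪｛ ψ ｝) χ = Φ χ ⊎ χ ≡ ψ

-- Suppose Φ ∪ {φ(x_n/x_m)} derives some ψ and ¬ψ.  With R1 and either R2, R8
-- or R9 the same finite antecedent then derives both x_{n+1} ≡ x_{n+1} and its
-- negation, formulas in which x_n is not free.  Since x_n is not free in
-- Φ ∪ {∃x_m φ} either, R5 replaces the assumption φ(x_n/x_m) by ∃x_m φ in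
-- both derivations, so Φ ∪ {∃x_m φ} is inconsistent too.
module Submission where

open import Defs
open import Data.Nat using (ℕ; suc)
open import Data.Nat.Properties using (1+n≢n)
open import Data.Integer using (ℤ)
open import Data.Product using (_×_; _,_; Σ)
open import Data.Sum using (_⊎_; inj₁; inj₂; [_,_]′)
open import Data.List using (List; []; _∷_; _++_)
open import Data.List.Membership.Propositional using (_∈_; _∉_; find)
open import Data.List.Membership.Propositional.Properties using (∈-++⁻; ∈-concatMap⁻)
open import Data.List.Relation.Unary.Any using (here; there)
open import Data.List.Relation.Binary.Subset.Propositional using (_⊆_)
open import Data.List.Relation.Binary.Subset.Propositional.Properties
  using (⊆-refl; ⊆-trans; xs⊆x∷xs; ∷⁺ʳ; ∈-∷⁺ʳ; xs⊆xs++ys; xs⊆ys++xs)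
open import Relation.Binary.PropositionalEquality using (_≡_; _≢_; refl; sym)
open import Function using (_∘_)
open import Function.Bundles using (_↣_)

split-⊆-insert : {A : Set} {P : A → Set} {a : A} (L : List A) →
                 (∀ {x} → x ∈ L → P x ⊎ x ≡ a) →
                 Σ (List A) λ G → (∀ {x} → x ∈ G → P x) × L ⊆ a ∷ G
split-⊆-insert [] _ = [] , (λ ()) , (λ ())
split-⊆-insert {a = a} (x ∷ L) L⊆P∪a
  with split-⊆-insert L (L⊆P∪a ∘ there) | L⊆P∪a (here refl)
... | G , G⊆P , L⊆a∷G | inj₁ Px =
  x ∷ G ,
  (λ { (here refl) → Px ; (there y∈G) → G⊆P y∈G }) ,
  ∈-∷⁺ʳ (there (here refl)) (⊆-trans L⊆a∷G (∷⁺ʳ a (xs⊆x∷xs G x)))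
... | G , G⊆P , L⊆a∷G | inj₂ x≡a = G , G⊆P , ∈-∷⁺ʳ (here x≡a) L⊆a∷G

module _ {Sym : Set} {ar : Sym → ℤ} where
  open Syntax Sym ar

  ∉-freeL : ∀ {x Γ} → (∀ {ψ} → ψ ∈ Γ → x ∉ free ψ) → x ∉ freeL Γ
  ∉-freeL x∉Γ x∈ with find (∈-concatMap⁻ free x∈)
  ... | _ , ψ∈Γ , x∈ψ = x∉Γ ψ∈Γ x∈ψ

  ∉-free-neg : ∀ {x χ} → x ∉ free χ → x ∉ free (neg χ)
  ∉-free-neg {χ = χ} x∉χ = [ x∉χ , x∉χ ]′ ∘ ∈-++⁻ (free χ)

  ∉-free-≡-var : ∀ {x y} → x ≢ y → x ∉ free (eq (var y) (var y))
  ∉-free-≡-var x≢y (here x≡y)         = x≢y x≡y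
  ∉-free-≡-var x≢y (there (here x≡y)) = x≢y x≡y

  module _ {D : Rule → Set} (dR1 : D R1) where

    ⊢-common-antecedent : ∀ {Φ ψ} → Φ ⊢[ D ] ψ → Φ ⊢[ D ] neg ψ →
                          Σ (List Formula) λ Γ → (∀ {χ} → χ ∈ Γ → Φ χ) ×
                          Der D Γ ψ × Der D Γ (neg ψ)
    ⊢-common-antecedent (Γ₁ , Γ₁⊆Φ , d₁) (Γ₂ , Γ₂⊆Φ , d₂) =
      Γ₁ ++ Γ₂ ,
      [ Γ₁⊆Φ , Γ₂⊆Φ ]′ ∘ ∈-++⁻ Γ₁ ,
      r1 dR1 d₁ (xs⊆xs++ys Γ₁ Γ₂) ,
      r1 dR1 d₂ (xs⊆ys++xs Γ₂ Γ₁)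

    Explosive : Set
    Explosive = ∀ {Δ ψ} → Der D Δ ψ → Der D Δ (neg ψ) →
                ∀ t → Der D Δ (eq t t) × Der D Δ (neg (eq t t))

    explosive-R2-R8 : D R2 → D R8 → Explosive
    explosive-R2-R8 dR2 dR8 dψ d¬ψ t =
      r1 dR1 (r2 dR2) (λ ()) ,
      r8 dR8 (r1 dR1 dψ there) (r1 dR1 d¬ψ there)

    explosive-R9 : D R9 → Explosive
    explosive-R9 dR9 dψ d¬ψ t =
      r9 dR9 (r1 dR1 dψ there) (r1 dR1 d¬ψ there) ,
      r9 dR9 (r1 dR1 dψ there) (r1 dR1 d¬ψ there)

    consistent-instance : D R5 → Explosive →
      ∀ Φ φ m → Consistent D (Φ ∪｛ ex m φ ｝) →
      ∀ n → (∀ χ → (Φ ∪｛ ex m φ ｝) χ → n ∉ free χ) →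
      Consistent D (Φ ∪｛ φ [ var n / m ] ｝)
    consistent-instance dR5 explode Φ φ m con n n-fresh ψ (⊢ψ , ⊢¬ψ)
      with ⊢-common-antecedent ⊢ψ ⊢¬ψ
    ... | Γ , Γ⊆Φ∪φ' , dψ , d¬ψ with split-⊆-insert Γ Γ⊆Φ∪φ'
    ... | G , G⊆Φ , Γ⊆φ'∷G
      with explode (r1 dR1 dψ Γ⊆φ'∷G) (r1 dR1 d¬ψ Γ⊆φ'∷G) (var (suc n))
    ... | dχ , d¬χ =
      con χ ((Γ' , Γ'⊆Φ∪∃ , ∃-elim dχ n∉χ) ,
             (Γ' , Γ'⊆Φ∪∃ , ∃-elim d¬χ (∉-free-neg {χ = χ} n∉χ)))
      where
      χ : Formula
      χ = eq (var (suc n)) (var (suc n))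

      n∉χ : n ∉ free χ
      n∉χ = ∉-free-≡-var (1+n≢n ∘ sym)

      Γ' : List Formula
      Γ' = ex m φ ∷ G

      Γ'⊆Φ∪∃ : ∀ {θ} → θ ∈ Γ' → (Φ ∪｛ ex m φ ｝) θ
      Γ'⊆Φ∪∃ (here refl)  = inj₂ refl
      Γ'⊆Φ∪∃ (there θ∈G) = inj₁ (G⊆Φ θ∈G)

      ∃-elim : ∀ {θ} → Der D (φ [ var n / m ] ∷ G) θ → n ∉ free θ → Der D Γ' θ
      ∃-elim {θ} d n∉θ = r5 dR5 d (∉-freeL n∉) (⊆-refl , ⊆-refl)
        where
        n∉ : ∀ {ρ} → ρ ∈ ex m φ ∷ θ ∷ G → n ∉ free ρ
        n∉ (here refl)         = n-fresh _ (inj₂ refl)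
        n∉ (there (here refl)) = n∉θ
        n∉ (there (there ρ∈G)) = n-fresh _ (inj₁ (G⊆Φ ρ∈G))

mainTheorem6 : (Sym : Set) (ar : Sym → ℤ) → Sym ↣ ℕ →
    let open Syntax Sym ar in
    (D : Rule → Set) →
    (D R1 × D R2 × D R4 × D R5 × D R8) ⊎ (D R1 × D R2 × D R4 × D R5 × D R9) →
    (Φ : Formula → Set) (φ : Formula) (m : ℕ) →
    Consistent D (Φ ∪｛ ex m φ ｝) →
    (n : ℕ) → (∀ χ → (Φ ∪｛ ex m φ ｝) χ → n ∉ free χ) →
    Consistent D (Φ ∪｛ φ [ var n / m ] ｝)
mainTheorem6 _ _ _ _ (inj₁ (dR1 , dR2 , _ , dR5 , dR8)) =
  consistent-instance dR1 dR5 (explosive-R2-R8 dR1 dR2 dR8)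
mainTheorem6 _ _ _ _ (inj₂ (dR1 , _ , _ , dR5 , dR9)) =
  consistent-instance dR1 dR5 (explosive-R9 dR1 dR9)
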